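{- For a positive integer $n$, let $\mathrm{XI}_n$ be the graph consisting of two cycles $v_1 v_2 \cdots v_{3n}$ and $u_1 u_2 \cdots u_{3n}$ together with the edges $v_{3i}u_{3i+1}$, $v_{3i+1}u_{3i}$, and $v_{3i+2}u_{3i+2}$ for all $i \in \{0, \dots, n-1\}$, with indices taken modulo $3n$. Then for every positive integer $k$, $\chi'_{\mathrm{irr}}(\mathrm{XI}_{2k}) = 2$ and $\chi'_{\mathrm{irr}}(\mathrm{XI}_{2k+1}) = 3$.
   Context: A graph is locally irregular if no two adjacent vertices have the same degree. A locally irregular edge-coloring of a graph is an (not necessarily proper) edge-coloring such that the edges of each color induce a locally irregular graph; equivalently, for every edge $xy$ of color $i$, the numbers of edges of color $i$ at $x$ and at $y$ differ. $\chi'_{\mathrm{irr}}(G)$ denotes the minimum number of colors in such a coloring of $G$. -}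

module Defs where

open import Data.Nat using (ℕ; zero; suc; _+_; _*_; _<_; _%_)
open import Data.Nat.Properties using () renaming (_≟_ to _≟ℕ_)
open import Data.Fin using (Fin)
open import Data.List using (List; []; _∷_; length; lookup; map; upTo; concatMap; allFin; _++_)
open import Data.Nat.ListAction using (sum)
open import Data.Product using (_×_; _,_; proj₁; proj₂; Σ; ∃)
open import Relation.Binary.PropositionalEquality using (_≡_; _≢_)
open import Relation.Nullary using (¬_; Dec; yes; no)
open import Relation.Nullary.Decidable using (⌊_⌋)
open import Data.Bool using (Bool; true; false; _∧_; _∨_)
open import Data.Fin using () renaming (_≟_ to _≟F_)

-- A finite (multi)graph: a vertex type with decidable equality and a list of
-- edges, each given by its two endpoints.  Edges are identified by their
-- position in the list.
record Graph : Set₁ where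
  field
    V     : Set
    _≟V_  : (x y : V) → Dec (x ≡ y)
    edges : List (V × V)

open Graph public

Edge : Graph → Set
Edge G = Fin (length (edges G))

ends : (G : Graph) → Edge G → V G × V G
ends G e = lookup (edges G) e

Coloring : Graph → ℕ → Set
Coloring G k = Edge G → Fin k

incident : (G : Graph) → V G → Edge G → Bool
incident G x e = ⌊ _≟V_ G x (proj₁ (ends G e)) ⌋ ∨ ⌊ _≟V_ G x (proj₂ (ends G e)) ⌋

colDeg : (G : Graph) {k : ℕ} → Coloring G k → Fin k → V G → ℕ
colDeg G c i x = sum (map f (allFin (length (edges G))))
  where
  f : Edge G → ℕ
  f e with ⌊ c e ≟F i ⌋ ∧ incident G x e
  ... | true  = 1
  ... | false = 0

LocallyIrregularColoring : (G : Graph) {k : ℕ} → Coloring G k → Set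
LocallyIrregularColoring G c =
  (e : Edge G) → colDeg G c (c e) (proj₁ (ends G e)) ≢ colDeg G c (c e) (proj₂ (ends G e))

IrrColorable : Graph → ℕ → Set
IrrColorable G k = Σ (Coloring G k) (LocallyIrregularColoring G)

IrrChromaticIndex : Graph → ℕ → Set
IrrChromaticIndex G k = IrrColorable G k × ((j : ℕ) → j < k → ¬ IrrColorable G j)

data Side : Set where
  vSide uSide : Side

_≟S_ : (a b : Side) → Dec (a ≡ b)
vSide ≟S vSide = yes _≡_.refl
vSide ≟S uSide = no λ ()
uSide ≟S vSide = no λ ()
uSide ≟S uSide = yes _≡_.refl

-- vertex (vSide , j) is v_j and (uSide , j) is u_j, j ∈ {0,…,3n-1}
-- (index 0 plays the role of the paper's index 3n)
XIV : Set
XIV = Side × ℕ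

_≟XI_ : (x y : XIV) → Dec (x ≡ y)
(a , i) ≟XI (b , j) with a ≟S b | i ≟ℕ j
... | yes _≡_.refl | yes _≡_.refl = yes _≡_.refl
... | no p | _ = no λ { _≡_.refl → p _≡_.refl }
... | yes _ | no q = no λ { _≡_.refl → q _≡_.refl }

_mod'_ : ℕ → ℕ → ℕ
a mod' zero = a
a mod' suc m = a % suc m

XIedges : ℕ → List (XIV × XIV)
XIedges n =
     map (λ j → ((vSide , j) , (vSide , (j + 1) mod' N))) (upTo N)
  ++ map (λ j → ((uSide , j) , (uSide , (j + 1) mod' N))) (upTo N)
  ++ concatMap (λ i →
         ((vSide , 3 * i) , (uSide , (3 * i + 1) mod' N))
       ∷ ((vSide , 3 * i + 1) , (uSide , 3 * i))
       ∷ ((vSide , 3 * i + 2) , (uSide , 3 * i + 2))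
       ∷ []) (upTo n)
  where
  N = 3 * n

XI : ℕ → Graph
XI n = record { V = XIV ; _≟V_ = _≟XI_ ; edges = XIedges n }

{-# OPTIONS --safe #-}
-- XI_n is cubic.  Cut it into n blocks: block i consists of the cycle edges
-- s_{3i}s_{3i+1}, s_{3i+1}s_{3i+2}, s_{3i+2}s_{3i+3} for s ∈ {v, u} and of the
-- cross edges at v_{3i}, v_{3i+1}, v_{3i+2}.  Whether the edges at the six
-- vertices s_{3i}, s_{3i+1}, s_{3i+2} are irregular, apart from the two edges
-- leaving towards block i + 1, depends only on block i and on five colours of
-- block i - 1, its interface.  So a locally irregular colouring is the same as
-- a cyclic sequence of n blocks each compatible with the interface of its
-- predecessor.  Repeating one suitable block gives a 3-colouring, alternating
-- two suitable blocks a 2-colouring when n is even, and a single colour fails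
-- because XI_n is regular.  For two colours, a potential on the 32 interfaces,
-- checked against all compatible pairs, either lowers its rank or keeps it and
-- switches its side from each block to the next.  Around the cycle the rank
-- cannot drop, so the sides alternate and n is even.
module Submission where

open import Defs
open import Data.Nat using (ℕ; zero; suc; _+_; _*_; _∸_; _<_; _≤_; z≤n; s≤s; s<s⁻¹; pred; _%_; _<?_; parity)
  renaming (_≟_ to _≟ℕ_)
open import Data.Nat.Properties using (+-0-monoid; +-commutativeSemigroup; +-comm; +-identityʳ;
  +-suc; *-suc; ≤-trans; ≤-refl; ≤-antisym; <⇒≤; n<1+n; n≤1+n; <-irrefl; <-≤-trans; suc-injective; ≮⇒≥;
  +-monoʳ-<; +-monoʳ-≤; *-monoʳ-≤; m≤m+n; m≤n+m; m+[n∸m]≡n; +-cancelˡ-<; +-cancelˡ-≡)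
open import Data.Nat.DivMod using (m%n<n; n%n≡0; m<n⇒m%n≡m)
import Data.Nat.ListAction as List
open import Algebra.Properties.CommutativeSemigroup +-commutativeSemigroup using (x∙yz≈y∙xz)
open import Data.Bool using (Bool; true; false; _∧_; T)
open import Data.Bool.Properties using (∧-identityʳ; ∧-zeroʳ; T-≡; T-∨)
open import Data.Fin using (Fin; zero; suc; toℕ; fromℕ<; _≟_)
open import Data.Fin.Patterns using (0F; 1F; 2F)
open import Data.Fin.Properties using (toℕ-fromℕ<; fromℕ<-toℕ; toℕ-injective; toℕ<n; all?)
open import Data.List using (List; []; _∷_; _++_; map; length; lookup; tabulate; allFin; applyUpTo; upTo; concatMap)
open import Data.List.Properties using (length-map; length-applyUpTo; length-++)
open import Data.Vec using (Vec; []; _∷_)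
open import Data.Vec.Functional using (Vector; updateAt)
open import Data.Vec.Functional.Properties using (updateAt-updates; updateAt-minimal)
open import Algebra.Properties.Monoid.Sum +-0-monoid using (sum; sum-cong-≗; sum-replicate-zero)
open import Data.Parity.Base using (Parity; 0ℙ; 1ℙ; _⁻¹) renaming (_+_ to _+ℙ_)
open import Data.Parity.Properties using (suc-homo-⁻¹; ⁻¹-selfInverse; +-homo-+; *-homo-*)
  renaming (+-assoc to +ℙ-assoc; +-cancelʳ-≡ to +ℙ-cancelʳ-≡; _≟_ to _≟ℙ_)
open import Data.Product using (_×_; _,_; proj₁; proj₂)
open import Data.Sum using (_⊎_; inj₁; inj₂)
import Data.Sum as Sum
open import Function using (const)
open import Function.Bundles using (_⇔_; mk⇔; Equivalence)
open import Relation.Nullary using (¬_; Dec; yes; no; contradiction; ¬?; _×-dec_; _⊎-dec_; _→-dec_)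
open import Relation.Nullary.Decidable using (⌊_⌋; toWitness; fromWitness; map′; from-yes)
open import Relation.Binary.PropositionalEquality

-- Colour degrees in graphs

indicator : Bool → ℕ
indicator true  = 1
indicator false = 0

sum-map-tabulate : ∀ {A : Set} {m} (f : A → ℕ) (g : Fin m → A) →
                   List.sum (map f (tabulate g)) ≡ sum (λ e → f (g e))
sum-map-tabulate {m = zero}  f g = refl
sum-map-tabulate {m = suc m} f g = cong (f (g zero) +_) (sum-map-tabulate f (λ e → g (suc e)))

sum-updateAt-zero : ∀ {m} (f : Vector ℕ m) (a : Fin m) → sum f ≡ f a + sum (updateAt f a (const 0))
sum-updateAt-zero {suc m} f zero    = refl
sum-updateAt-zero {suc m} f (suc a) =
  trans (cong (f zero +_) (sum-updateAt-zero (λ e → f (suc e)) a)) (x∙yz≈y∙xz (f zero) (f (suc a)) _)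

sum-zero : ∀ {m} (f : Vector ℕ m) → (∀ e → f e ≡ 0) → sum f ≡ 0
sum-zero {m} f f≗0 = trans (sum-cong-≗ f≗0) (sum-replicate-zero m)

sum-supported-on-three : ∀ {m} (f : Vector ℕ m) {a b d : Fin m} → b ≢ a → d ≢ a → d ≢ b →
                         (∀ e → e ≢ a → e ≢ b → e ≢ d → f e ≡ 0) → sum f ≡ f a + (f b + f d)
sum-supported-on-three {m} f {a} {b} {d} b≢a d≢a d≢b vanishes = begin
  sum f                          ≡⟨ sum-updateAt-zero f a ⟩
  f a + sum f₁                   ≡⟨ cong (f a +_) (sum-updateAt-zero f₁ b) ⟩
  f a + (f₁ b + sum f₂)          ≡⟨ cong (λ t → f a + (f₁ b + t)) (sum-updateAt-zero f₂ d) ⟩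
  f a + (f₁ b + (f₂ d + sum f₃)) ≡⟨ cong₂ (λ x y → f a + (x + (y + sum f₃))) f₁b≡fb f₂d≡fd ⟩
  f a + (f b + (f d + sum f₃))   ≡⟨ cong (λ t → f a + (f b + (f d + t))) (sum-zero f₃ rest) ⟩
  f a + (f b + (f d + 0))        ≡⟨ cong (λ t → f a + (f b + t)) (+-identityʳ (f d)) ⟩
  f a + (f b + f d)              ∎
  where
  open ≡-Reasoning
  f₁ f₂ f₃ : Vector ℕ m
  f₁ = updateAt f a (const 0)
  f₂ = updateAt f₁ b (const 0)
  f₃ = updateAt f₂ d (const 0)
  f₁b≡fb : f₁ b ≡ f b
  f₁b≡fb = updateAt-minimal b a f b≢a
  f₂d≡fd : f₂ d ≡ f d
  f₂d≡fd = trans (updateAt-minimal d b f₁ d≢b) (updateAt-minimal d a f d≢a)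
  rest : ∀ e → f₃ e ≡ 0
  rest e with e ≟ d | e ≟ b | e ≟ a
  ... | yes refl | _        | _        = updateAt-updates d f₂
  ... | no e≢d   | yes refl | _        = trans (updateAt-minimal e d f₂ e≢d) (updateAt-updates b f₁)
  ... | no e≢d   | no e≢b   | yes refl =
    trans (updateAt-minimal e d f₂ e≢d) (trans (updateAt-minimal e b f₁ e≢b) (updateAt-updates a f))
  ... | no e≢d   | no e≢b   | no e≢a   =
    trans (updateAt-minimal e d f₂ e≢d) (trans (updateAt-minimal e b f₁ e≢b)
      (trans (updateAt-minimal e a f e≢a) (vanishes e e≢a e≢b e≢d)))

-- colDeg sums a function local to Defs; it can only be named by reading it off
-- the type of a reflexivity proof.
private
  summand : ∀ {m} {F : Fin m → ℕ} → List.sum (map F (allFin m)) ≡ List.sum (map F (allFin m)) → Fin m → ℕ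
  summand {F = F} _ = F

colDeg-as-sum : (G : Graph) {k : ℕ} (c : Coloring G k) (i : Fin k) (x : V G) →
                colDeg G c i x ≡ sum (λ e → indicator (⌊ c e ≟ i ⌋ ∧ incident G x e))
colDeg-as-sum G c i x = trans (sum-map-tabulate F (λ e → e)) (sum-cong-≗ F≗indicator)
  where
  F : Edge G → ℕ
  F = summand (refl {x = colDeg G c i x})
  F≗indicator : ∀ e → F e ≡ indicator (⌊ c e ≟ i ⌋ ∧ incident G x e)
  F≗indicator e with ⌊ c e ≟ i ⌋ ∧ incident G x e
  ... | true  = refl
  ... | false = refl

module _ (G : Graph) where

  private
    T-incident : ∀ x e → T (incident G x e) ⇔
                 (T ⌊ _≟V_ G x (proj₁ (ends G e)) ⌋ ⊎ T ⌊ _≟V_ G x (proj₂ (ends G e)) ⌋)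
    T-incident x e = T-∨ {⌊ _≟V_ G x (proj₁ (ends G e)) ⌋} {⌊ _≟V_ G x (proj₂ (ends G e)) ⌋}

  incident-endpoint₁ : (e : Edge G) → incident G (proj₁ (ends G e)) e ≡ true
  incident-endpoint₁ e = Equivalence.to T-≡ (Equivalence.from (T-incident _ e) (inj₁ (fromWitness refl)))

  incident-endpoint₂ : (e : Edge G) → incident G (proj₂ (ends G e)) e ≡ true
  incident-endpoint₂ e = Equivalence.to T-≡ (Equivalence.from (T-incident _ e) (inj₂ (fromWitness refl)))

  incident⇒endpoint : ∀ {x} (e : Edge G) → incident G x e ≡ true →
                      x ≡ proj₁ (ends G e) ⊎ x ≡ proj₂ (ends G e)
  incident⇒endpoint {x} e x∈e =
    Sum.map toWitness toWitness (Equivalence.to (T-incident x e) (Equivalence.from T-≡ x∈e))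

count₃ : ∀ {k} → Fin k → Fin k → Fin k → Fin k → ℕ
count₃ i a b d = indicator ⌊ a ≟ i ⌋ + (indicator ⌊ b ≟ i ⌋ + indicator ⌊ d ≟ i ⌋)

count₃-cong : ∀ {k} (i : Fin k) {a a′ b b′ d d′ : Fin k} → a ≡ a′ → b ≡ b′ → d ≡ d′ →
              count₃ i a b d ≡ count₃ i a′ b′ d′
count₃-cong i refl refl refl = refl

count₃-single-colour : (i a b d : Fin 1) → count₃ i a b d ≡ 3
count₃-single-colour 0F 0F 0F 0F = refl

record IncidentExactly (G : Graph) (x : V G) (a b d : Edge G) : Set where
  field
    b≢a : b ≢ a
    d≢a : d ≢ a
    d≢b : d ≢ b
    incident-a : incident G x a ≡ true
    incident-b : incident G x b ≡ true
    incident-d : incident G x d ≡ true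
    only : ∀ e → incident G x e ≡ true → e ≡ a ⊎ e ≡ b ⊎ e ≡ d

colDeg≡count₃ : (G : Graph) {k : ℕ} (c : Coloring G k) (i : Fin k) {x : V G} {a b d : Edge G} →
                IncidentExactly G x a b d → colDeg G c i x ≡ count₃ i (c a) (c b) (c d)
colDeg≡count₃ G c i {x} {a} {b} {d} incidentExactly = begin
  colDeg G c i x             ≡⟨ colDeg-as-sum G c i x ⟩
  sum term                   ≡⟨ sum-supported-on-three term b≢a d≢a d≢b vanishes ⟩
  term a + (term b + term d) ≡⟨ cong₂ _+_ (on-x incident-a) (cong₂ _+_ (on-x incident-b) (on-x incident-d)) ⟩
  count₃ i (c a) (c b) (c d) ∎
  where
  open ≡-Reasoning
  open IncidentExactly incidentExactly
  term : Edge G → ℕ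
  term e = indicator (⌊ c e ≟ i ⌋ ∧ incident G x e)
  on-x : ∀ {e} → incident G x e ≡ true → term e ≡ indicator ⌊ c e ≟ i ⌋
  on-x {e} x∈e rewrite x∈e = cong indicator (∧-identityʳ _)
  vanishes : ∀ e → e ≢ a → e ≢ b → e ≢ d → term e ≡ 0
  vanishes e e≢a e≢b e≢d with incident G x e in x∈e
  ... | false = cong indicator (∧-zeroʳ ⌊ c e ≟ i ⌋)
  ... | true with only e x∈e
  ...   | inj₁ e≡a        = contradiction e≡a e≢a
  ...   | inj₂ (inj₁ e≡b) = contradiction e≡b e≢b
  ...   | inj₂ (inj₂ e≡d) = contradiction e≡d e≢d

no-irrColoring-with-no-colours : (G : Graph) → Edge G → ¬ IrrColorable G 0
no-irrColoring-with-no-colours G e (c , _) with c e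
... | ()

no-irrColoring-with-one-colour : (G : Graph) (e : Edge G) {x y : V G} {a b d a′ b′ d′ : Edge G} →
  ends G e ≡ (x , y) → IncidentExactly G x a b d → IncidentExactly G y a′ b′ d′ → ¬ IrrColorable G 1
no-irrColoring-with-one-colour G e {a = a} {b} {d} {a′} {b′} {d′} refl incident₁ incident₂ (c , irregular) =
  irregular e (begin
    colDeg G c (c e) (proj₁ (ends G e)) ≡⟨ colDeg≡count₃ G c (c e) incident₁ ⟩
    count₃ (c e) (c a) (c b) (c d)       ≡⟨ count₃-single-colour (c e) (c a) (c b) (c d) ⟩
    3                                    ≡⟨ count₃-single-colour (c e) (c a′) (c b′) (c d′) ⟨
    count₃ (c e) (c a′) (c b′) (c d′)    ≡⟨ colDeg≡count₃ G c (c e) incident₂ ⟨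
    colDeg G c (c e) (proj₂ (ends G e))  ∎)
  where open ≡-Reasoning

extend : ∀ {A : Set} {l} → A → (Fin l → A) → ℕ → A
extend {l = l} d f p with p <? l
... | yes p<l = f (fromℕ< p<l)
... | no  _   = d

extend-toℕ : ∀ {A : Set} {l} (d : A) (f : Fin l → A) (e : Fin l) → f e ≡ extend d f (toℕ e)
extend-toℕ {l = l} d f e with toℕ e <? l
... | yes e<l = cong f (sym (fromℕ<-toℕ e e<l))
... | no  e≮l = contradiction (toℕ<n e) e≮l

-- Lists and arithmetic modulo 3

nth : {A : Set} → A → List A → ℕ → A
nth d []       p       = d
nth d (x ∷ xs) zero    = x
nth d (x ∷ xs) (suc p) = nth d xs p

module _ {A : Set} (d : A) where

  lookup≡nth : (xs : List A) (e : Fin (length xs)) → lookup xs e ≡ nth d xs (toℕ e)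
  lookup≡nth (x ∷ xs) zero    = refl
  lookup≡nth (x ∷ xs) (suc e) = lookup≡nth xs e

  nth-++ˡ : (xs ys : List A) {l p : ℕ} → length xs ≡ l → p < l → nth d (xs ++ ys) p ≡ nth d xs p
  nth-++ˡ (x ∷ xs) ys {p = zero}  refl _         = refl
  nth-++ˡ (x ∷ xs) ys {p = suc p} refl (s≤s p<l) = nth-++ˡ xs ys refl p<l

  nth-++ʳ : (xs ys : List A) {l : ℕ} → length xs ≡ l → ∀ p → nth d (xs ++ ys) (l + p) ≡ nth d ys p
  nth-++ʳ []       ys refl p = refl
  nth-++ʳ (x ∷ xs) ys refl p = nth-++ʳ xs ys refl p

  nth-map-applyUpTo : ∀ {B : Set} (f : B → A) (h : ℕ → B) {m p : ℕ} → p < m →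
                      nth d (map f (applyUpTo h m)) p ≡ f (h p)
  nth-map-applyUpTo f h {suc m} {zero}  _         = refl
  nth-map-applyUpTo f h {suc m} {suc p} (s≤s p<m) = nth-map-applyUpTo f (λ x → h (suc x)) p<m

triples : ∀ {A B : Set} → (B → Fin 3 → A) → List B → List A
triples f = concatMap (λ y → f y 0F ∷ f y 1F ∷ f y 2F ∷ [])

3*suc+ : ∀ i r → 3 * suc i + r ≡ suc (suc (suc (3 * i + r)))
3*suc+ i r = cong (_+ r) (*-suc 3 i)

3*+<3* : ∀ {m} i (r : Fin 3) → i < m → 3 * i + toℕ r < 3 * m
3*+<3* {m} i r i<m = ≤-trans (+-monoʳ-< (3 * i) (toℕ<n r))
  (subst (_≤ 3 * m) (trans (*-suc 3 i) (+-comm 3 (3 * i))) (*-monoʳ-≤ 3 i<m))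

length-triples : ∀ {A B : Set} (f : B → Fin 3 → A) (h : ℕ → B) m → length (triples f (applyUpTo h m)) ≡ 3 * m
length-triples f h zero    = refl
length-triples f h (suc m) =
  trans (cong (λ l → suc (suc (suc l))) (length-triples f (λ x → h (suc x)) m)) (sym (*-suc 3 m))

nth-triples : ∀ {A B : Set} (d : A) (f : B → Fin 3 → A) (h : ℕ → B) {m i : ℕ} → i < m → (r : Fin 3) →
              nth d (triples f (applyUpTo h m)) (3 * i + toℕ r) ≡ f (h i) r
nth-triples d f h {suc m} {zero}  _ 0F = refl
nth-triples d f h {suc m} {zero}  _ 1F = refl
nth-triples d f h {suc m} {zero}  _ 2F = refl
nth-triples d f h {suc m} {suc i} (s≤s i<m) r =
  trans (cong (nth d (triples f (applyUpTo h (suc m)))) (3*suc+ i (toℕ r))) (nth-triples d f (λ x → h (suc x)) i<m r)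

data Residue₃ (m q : ℕ) : Set where
  residue : (i : ℕ) (r : Fin 3) → i < m → q ≡ 3 * i + toℕ r → Residue₃ m q

residue₃ : ∀ m q → q < 3 * m → Residue₃ m q
residue₃ (suc m) 0 _ = residue 0 0F (s≤s z≤n) refl
residue₃ (suc m) 1 _ = residue 0 1F (s≤s z≤n) refl
residue₃ (suc m) 2 _ = residue 0 2F (s≤s z≤n) refl
residue₃ (suc m) (suc (suc (suc q))) q+3<3m+3
  with residue₃ m q (s<s⁻¹ (s<s⁻¹ (s<s⁻¹ (subst (suc (suc (suc q)) <_) (*-suc 3 m) q+3<3m+3))))
... | residue i r i<m refl = residue (suc i) r (s≤s i<m) (sym (3*suc+ i (toℕ r)))

swap₀₁ : Fin 3 → Fin 3
swap₀₁ 0F = 1F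
swap₀₁ 1F = 0F
swap₀₁ 2F = 2F

flip₀₁ : ℕ → ℕ
flip₀₁ 0                   = 1
flip₀₁ 1                   = 0
flip₀₁ 2                   = 2
flip₀₁ (suc (suc (suc q))) = suc (suc (suc (flip₀₁ q)))

flip₀₁-involutive : ∀ q → flip₀₁ (flip₀₁ q) ≡ q
flip₀₁-involutive 0                   = refl
flip₀₁-involutive 1                   = refl
flip₀₁-involutive 2                   = refl
flip₀₁-involutive (suc (suc (suc q))) = cong (λ x → suc (suc (suc x))) (flip₀₁-involutive q)

flip₀₁-3*+ : ∀ i r → flip₀₁ (3 * i + toℕ r) ≡ 3 * i + toℕ (swap₀₁ r)
flip₀₁-3*+ zero    0F = refl
flip₀₁-3*+ zero    1F = refl
flip₀₁-3*+ zero    2F = refl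
flip₀₁-3*+ (suc i) r  = begin
  flip₀₁ (3 * suc i + toℕ r)               ≡⟨ cong flip₀₁ (3*suc+ i (toℕ r)) ⟩
  suc (suc (suc (flip₀₁ (3 * i + toℕ r)))) ≡⟨ cong (λ x → suc (suc (suc x))) (flip₀₁-3*+ i r) ⟩
  suc (suc (suc (3 * i + toℕ (swap₀₁ r)))) ≡⟨ 3*suc+ i (toℕ (swap₀₁ r)) ⟨
  3 * suc i + toℕ (swap₀₁ r)               ∎
  where open ≡-Reasoning

flip₀₁< : ∀ {m q} → q < 3 * m → flip₀₁ q < 3 * m
flip₀₁< {m} {q} q<3m with residue₃ m q q<3m
... | residue i r i<m refl = subst (_< 3 * m) (sym (flip₀₁-3*+ i r)) (3*+<3* i (swap₀₁ r) i<m)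

module Cyclic (M : ℕ) where

  next : ℕ → ℕ
  next j = (j + 1) % suc M

  prev : ℕ → ℕ
  prev zero    = M
  prev (suc j) = j

  prev< : ∀ {j} → j < suc M → prev j < suc M
  prev< {zero}  _         = n<1+n M
  prev< {suc j} (s≤s j<M) = s≤s (<⇒≤ j<M)

  next< : ∀ j → next j < suc M
  next< j = m%n<n (j + 1) (suc M)

  next-suc : ∀ {j} → suc j < suc M → next j ≡ suc j
  next-suc {j} j+1<1+M = trans (m<n⇒m%n≡m (subst (_< suc M) (+-comm 1 j) j+1<1+M)) (+-comm j 1)

  next-prev : ∀ {j} → j < suc M → next (prev j) ≡ j
  next-prev {zero}  _         = trans (cong (_% suc M) (+-comm M 1)) (n%n≡0 (suc M))
  next-prev {suc j} j+1<1+M = next-suc j+1<1+M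

  prev-next : ∀ {j} → j < suc M → prev (next j) ≡ j
  prev-next {j} j<1+M with j + 1 <? suc M
  ... | yes j+1<1+M = cong prev (trans (m<n⇒m%n≡m j+1<1+M) (+-comm j 1))
  ... | no  j+1≮1+M = trans (cong prev (trans (cong (_% suc M) j+1≡1+M) (n%n≡0 (suc M))))
                            (sym (suc-injective (trans (+-comm 1 j) j+1≡1+M)))
    where
    j+1≡1+M : j + 1 ≡ suc M
    j+1≡1+M = ≤-antisym (subst (_≤ suc M) (+-comm 1 j) j<1+M) (≮⇒≥ j+1≮1+M)

  prev≢ : 0 < M → ∀ j → prev j ≢ j
  prev≢ 0<M zero    M≡0   = <-irrefl (sym M≡0) 0<M
  prev≢ 0<M (suc j) j≡1+j = <-irrefl j≡1+j (n<1+n j)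

-- Blocks

-- The colours of the edges of block i: sᵣᵣ₊₁ is s_{3i+r}s_{3i+r+1} and xᵣ is
-- the cross edge at v_{3i+r}, whose other end is u_{3i + swap₀₁ r}.
record Block (k : ℕ) : Set where
  constructor ⟨_,_,_∣_,_,_∣_,_,_⟩
  field v₀₁ v₁₂ v₂₃ u₀₁ u₁₂ u₂₃ x₀ x₁ x₂ : Fin k

record Interface (k : ℕ) : Set where
  field v₁₂ v₂₃ u₁₂ u₂₃ x₂ : Fin k

crossSlot : Side → Fin 3 → Fin 3
crossSlot vSide r = r
crossSlot uSide r = swap₀₁ r

crossSlot-2F : ∀ s → crossSlot s 2F ≡ 2F
crossSlot-2F vSide = refl
crossSlot-2F uSide = refl

module _ {k : ℕ} where
  open Block

  interface : Block k → Interface k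
  interface b = record { v₁₂ = v₁₂ b ; v₂₃ = v₂₃ b ; u₁₂ = u₁₂ b ; u₂₃ = u₂₃ b ; x₂ = x₂ b }

  cycleColour : Side → Fin 3 → Block k → Fin k
  cycleColour vSide 0F = v₀₁
  cycleColour vSide 1F = v₁₂
  cycleColour vSide 2F = v₂₃
  cycleColour uSide 0F = u₀₁
  cycleColour uSide 1F = u₁₂
  cycleColour uSide 2F = u₂₃

  crossColour : Fin 3 → Block k → Fin k
  crossColour 0F = x₀
  crossColour 1F = x₁
  crossColour 2F = x₂

  inner outgoing : Side → Interface k → Fin k
  inner vSide    = Interface.v₁₂
  inner uSide    = Interface.u₁₂
  outgoing vSide = Interface.v₂₃
  outgoing uSide = Interface.u₂₃

  inner-interface : ∀ s (b : Block k) → inner s (interface b) ≡ cycleColour s 1F b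
  inner-interface vSide b = refl
  inner-interface uSide b = refl

  outgoing-interface : ∀ s (b : Block k) → outgoing s (interface b) ≡ cycleColour s 2F b
  outgoing-interface vSide b = refl
  outgoing-interface uSide b = refl

  block-ext : {a b : Block k} → (∀ s r → cycleColour s r a ≡ cycleColour s r b) →
              (∀ r → crossColour r a ≡ crossColour r b) → a ≡ b
  block-ext {a = ⟨ _ , _ , _ ∣ _ , _ , _ ∣ _ , _ , _ ⟩} {b = ⟨ _ , _ , _ ∣ _ , _ , _ ∣ _ , _ , _ ⟩} cycle cross
    with cycle vSide 0F | cycle vSide 1F | cycle vSide 2F | cycle uSide 0F | cycle uSide 1F | cycle uSide 2F
       | cross 0F | cross 1F | cross 2F
  ... | refl | refl | refl | refl | refl | refl | refl | refl | refl = refl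

  -- The colour degrees at s_{3i}, s_{3i+1} and s_{3i+2}, where t is the
  -- interface of block i - 1 and b is block i.
  degree₀ : Side → Interface k → Block k → Fin k → ℕ
  degree₀ s t b i = count₃ i (cycleColour s 0F b) (outgoing s t) (crossColour (crossSlot s 0F) b)

  degree₁ : Side → Block k → Fin k → ℕ
  degree₁ s b i = count₃ i (cycleColour s 1F b) (cycleColour s 0F b) (crossColour (crossSlot s 1F) b)

  degree₂ : Side → Interface k → Fin k → ℕ
  degree₂ s t i = count₃ i (outgoing s t) (inner s t) (Interface.x₂ t)

  blockDegree : Side → Fin 3 → Interface k → Block k → Fin k → ℕ
  blockDegree s 0F t b = degree₀ s t b
  blockDegree s 1F t b = degree₁ s b
  blockDegree s 2F t b = degree₂ s (interface b)

  -- Irregularity of the edges s_{3i-1}s_{3i}, s_{3i}s_{3i+1} and s_{3i+1}s_{3i+2}.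
  CycleCompatible : Side → Interface k → Block k → Set
  CycleCompatible s t b =
    degree₂ s t (outgoing s t) ≢ degree₀ s t b (outgoing s t) ×
    degree₀ s t b (cycleColour s 0F b) ≢ degree₁ s b (cycleColour s 0F b) ×
    degree₁ s b (cycleColour s 1F b) ≢ degree₂ s (interface b) (cycleColour s 1F b)

  CrossCompatible : Fin 3 → Interface k → Block k → Set
  CrossCompatible r t b = blockDegree vSide r t b (crossColour r b) ≢ blockDegree uSide (swap₀₁ r) t b (crossColour r b)

  record Compatible (t : Interface k) (b : Block k) : Set where
    field
      cycle : ∀ s → CycleCompatible s t b
      cross : ∀ r → CrossCompatible r t b

  cycleCompatible? : ∀ s (t : Interface k) (b : Block k) → Dec (CycleCompatible s t b)
  cycleCompatible? s t b = ¬? (_ ≟ℕ _) ×-dec ¬? (_ ≟ℕ _) ×-dec ¬? (_ ≟ℕ _)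

  compatible? : (t : Interface k) (b : Block k) → Dec (Compatible t b)
  compatible? t b = map′ (λ (v , u , x) → record { cycle = λ { vSide → v ; uSide → u } ; cross = x })
                         (λ c → Compatible.cycle c vSide , Compatible.cycle c uSide , Compatible.cross c)
                         (cycleCompatible? vSide t b ×-dec cycleCompatible? uSide t b ×-dec all? (λ r → ¬? (_ ≟ℕ _)))

-- A potential for two colours

Descends : ℕ × Parity → ℕ × Parity → Set
Descends (r , p) (r′ , p′) = r′ < r ⊎ (r′ ≡ r × p′ ≡ p ⁻¹)

descends? : ∀ x y → Dec (Descends x y)
descends? (r , p) (r′ , p′) = r′ <? r ⊎-dec (r′ ≟ℕ r ×-dec p′ ≟ℙ p ⁻¹)

closed-descending-walk-even : (φ : ℕ → ℕ × Parity) (m : ℕ) →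
  (∀ {i} → i < m → Descends (φ i) (φ (suc i))) → Descends (φ m) (φ 0) → parity (suc m) ≡ 0ℙ
closed-descending-walk-even φ m step close = closing close (walk m ≤-refl)
  where
  rank : ℕ → ℕ
  rank i = proj₁ (φ i)
  side : ℕ → Parity
  side i = proj₂ (φ i)
  Invariant : ℕ → Set
  Invariant i = rank i ≤ rank 0 × (rank i ≡ rank 0 → side i ≡ parity i +ℙ side 0)
  next-side : ∀ i {p} → p ≡ parity i +ℙ side 0 → p ⁻¹ ≡ parity (suc i) +ℙ side 0
  next-side i {p} p≡ = begin
    1ℙ +ℙ p                    ≡⟨ cong (1ℙ +ℙ_) p≡ ⟩
    1ℙ +ℙ (parity i +ℙ side 0) ≡⟨ +ℙ-assoc 1ℙ (parity i) (side 0) ⟨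
    (1ℙ +ℙ parity i) +ℙ side 0 ≡⟨ cong (_+ℙ side 0) (+-homo-+ 1 i) ⟨
    parity (suc i) +ℙ side 0   ∎
    where open ≡-Reasoning
  walk : ∀ i → i ≤ m → Invariant i
  walk zero    _   = ≤-refl , λ _ → refl
  walk (suc i) i<m with walk i (≤-trans (n≤1+n i) i<m) | step i<m
  ... | (≤0 , _) | inj₁ lower =
    <⇒≤ (<-≤-trans lower ≤0) , λ eq → contradiction (<-≤-trans lower ≤0) (<-irrefl eq)
  ... | (≤0 , on-level) | inj₂ (same , flipped) =
    subst (_≤ rank 0) (sym same) ≤0 , λ eq → trans flipped (next-side i (on-level (trans (sym same) eq)))
  closing : Descends (φ m) (φ 0) → Invariant m → parity (suc m) ≡ 0ℙ
  closing (inj₁ lower) (≤0 , _) = contradiction (<-≤-trans lower ≤0) (<-irrefl refl)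
  closing (inj₂ (same , flipped)) (_ , on-level) =
    sym (+ℙ-cancelʳ-≡ (side 0) 0ℙ (parity (suc m)) (trans flipped (next-side m (on-level (sym same)))))

all-vectors? : ∀ {k m} {P : Vec (Fin k) m → Set} → (∀ v → Dec (P v)) → Dec (∀ v → P v)
all-vectors? {m = zero}  P? = map′ (λ p → λ { [] → p }) (λ f → f []) (P? [])
all-vectors? {m = suc m} P? = map′ (λ f → λ { (x ∷ v) → f x v }) (λ f x v → f (x ∷ v))
                                   (all? (λ x → all-vectors? (λ v → P? (x ∷ v))))

-- Found by a computer search over the transitions between interfaces; the
-- certificate below checks it against every compatible pair.
potential : Interface 2 → ℕ × Parity
potential t = table (Interface.v₂₃ t) (Interface.u₂₃ t) (Interface.v₁₂ t) (Interface.u₁₂ t) (Interface.x₂ t)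
  where
  table : Fin 2 → Fin 2 → Fin 2 → Fin 2 → Fin 2 → ℕ × Parity
  table 0F 0F 0F 0F 0F =  3 , 0ℙ
  table 0F 0F 0F 0F 1F =  4 , 0ℙ
  table 0F 0F 0F 1F 0F =  0 , 1ℙ
  table 0F 0F 0F 1F 1F =  2 , 1ℙ
  table 0F 0F 1F 0F 0F =  0 , 1ℙ
  table 0F 0F 1F 0F 1F =  2 , 1ℙ
  table 0F 0F 1F 1F 0F =  5 , 0ℙ
  table 0F 0F 1F 1F 1F =  6 , 0ℙ
  table 0F 1F 0F 0F 0F =  2 , 0ℙ
  table 0F 1F 0F 0F 1F =  0 , 0ℙ
  table 0F 1F 0F 1F 0F =  1 , 1ℙ
  table 0F 1F 0F 1F 1F =  1 , 0ℙ
  table 0F 1F 1F 0F 0F =  7 , 0ℙ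
  table 0F 1F 1F 0F 1F =  8 , 0ℙ
  table 0F 1F 1F 1F 0F =  0 , 0ℙ
  table 0F 1F 1F 1F 1F =  2 , 0ℙ
  table 1F 0F 0F 0F 0F =  2 , 0ℙ
  table 1F 0F 0F 0F 1F =  0 , 0ℙ
  table 1F 0F 0F 1F 0F =  9 , 0ℙ
  table 1F 0F 0F 1F 1F = 10 , 0ℙ
  table 1F 0F 1F 0F 0F =  1 , 1ℙ
  table 1F 0F 1F 0F 1F =  1 , 0ℙ
  table 1F 0F 1F 1F 0F =  0 , 0ℙ
  table 1F 0F 1F 1F 1F =  2 , 0ℙ
  table 1F 1F 0F 0F 0F = 11 , 0ℙ
  table 1F 1F 0F 0F 1F = 12 , 0ℙ
  table 1F 1F 0F 1F 0F =  2 , 1ℙ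
  table 1F 1F 0F 1F 1F =  0 , 1ℙ
  table 1F 1F 1F 0F 0F =  2 , 1ℙ
  table 1F 1F 1F 0F 1F =  0 , 1ℙ
  table 1F 1F 1F 1F 0F = 13 , 0ℙ
  table 1F 1F 1F 1F 1F = 14 , 0ℙ

interfaceOf : Vec (Fin 2) 5 → Interface 2
interfaceOf (v₁₂ ∷ v₂₃ ∷ u₁₂ ∷ u₂₃ ∷ x₂ ∷ []) =
  record { v₁₂ = v₁₂ ; v₂₃ = v₂₃ ; u₁₂ = u₁₂ ; u₂₃ = u₂₃ ; x₂ = x₂ }

blockOf : Vec (Fin 2) 9 → Block 2
blockOf (v₀₁ ∷ v₁₂ ∷ v₂₃ ∷ u₀₁ ∷ u₁₂ ∷ u₂₃ ∷ x₀ ∷ x₁ ∷ x₂ ∷ []) = ⟨ v₀₁ , v₁₂ , v₂₃ ∣ u₀₁ , u₁₂ , u₂₃ ∣ x₀ , x₁ , x₂ ⟩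

compatible⇒descends : (t : Interface 2) (b : Block 2) → Compatible t b → Descends (potential t) (potential (interface b))
compatible⇒descends t b = certificate
  (Interface.v₁₂ t ∷ Interface.v₂₃ t ∷ Interface.u₁₂ t ∷ Interface.u₂₃ t ∷ Interface.x₂ t ∷ [])
  (Block.v₀₁ b ∷ Block.v₁₂ b ∷ Block.v₂₃ b ∷ Block.u₀₁ b ∷ Block.u₁₂ b ∷ Block.u₂₃ b ∷
   Block.x₀ b ∷ Block.x₁ b ∷ Block.x₂ b ∷ [])
  where
  Certified : Vec (Fin 2) 5 → Vec (Fin 2) 9 → Set
  Certified s v = Compatible (interfaceOf s) (blockOf v) →
                  Descends (potential (interfaceOf s)) (potential (interface (blockOf v)))
  certificate : ∀ s v → Certified s v
  certificate = from-yes (all-vectors? λ s → all-vectors? λ v →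
    compatible? (interfaceOf s) (blockOf v) →-dec descends? (potential (interfaceOf s)) (potential (interface (blockOf v))))

-- The graph XI_n

-- In the edge list of XI n, position offset s + j holds the cycle edge
-- s_j s_{j+1} and position N + (N + q) the cross edge at v_q, which joins it
-- to u_{flip₀₁ q}.
module XI-positions (m : ℕ) where

  n N : ℕ
  n = suc m
  N = 3 * n

  open Cyclic (pred N) public

  G : Graph
  G = XI n

  pred-N : pred N ≡ 3 * m + 2
  pred-N = trans (cong pred (*-suc 3 m)) (+-comm 2 (3 * m))

  cycleEdges : Side → List (XIV × XIV)
  cycleEdges s = map (λ j → ((s , j) , (s , next j))) (upTo N)

  crossEdge : ℕ → Fin 3 → XIV × XIV
  crossEdge i 0F = (vSide , 3 * i)     , (uSide , (3 * i + 1) mod' N)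
  crossEdge i 1F = (vSide , 3 * i + 1) , (uSide , 3 * i)
  crossEdge i 2F = (vSide , 3 * i + 2) , (uSide , 3 * i + 2)

  length-cycleEdges : ∀ s → length (cycleEdges s) ≡ N
  length-cycleEdges s = trans (length-map _ (upTo N)) (length-applyUpTo (λ j → j) N)

  length-edges : length (edges G) ≡ N + (N + N)
  length-edges = trans (length-++ (cycleEdges vSide)) (cong₂ _+_ (length-cycleEdges vSide)
    (trans (length-++ (cycleEdges uSide)) (cong₂ _+_ (length-cycleEdges uSide) (length-triples crossEdge (λ j → j) n))))

  offset : Side → ℕ
  offset vSide = 0
  offset uSide = N

  endsAt : ℕ → XIV × XIV
  endsAt = nth ((vSide , 0) , (vSide , 0)) (edges G)

  ends≡endsAt : (e : Edge G) → ends G e ≡ endsAt (toℕ e)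
  ends≡endsAt = lookup≡nth _ (edges G)

  endsAt-cycle : ∀ s {j} → j < N → endsAt (offset s + j) ≡ ((s , j) , (s , next j))
  endsAt-cycle vSide {j} j<N =
    trans (nth-++ˡ _ (cycleEdges vSide) _ (length-cycleEdges vSide) j<N) (nth-map-applyUpTo _ _ (λ i → i) j<N)
  endsAt-cycle uSide {j} j<N =
    trans (nth-++ʳ _ (cycleEdges vSide) _ (length-cycleEdges vSide) j)
      (trans (nth-++ˡ _ (cycleEdges uSide) _ (length-cycleEdges uSide) j<N) (nth-map-applyUpTo _ _ (λ i → i) j<N))

  crossEdge≡ : ∀ {i} → i < n → (r : Fin 3) →
               crossEdge i r ≡ ((vSide , 3 * i + toℕ r) , (uSide , flip₀₁ (3 * i + toℕ r)))
  crossEdge≡ {i} i<n r = trans (edge r) (cong (λ q → (vSide , 3 * i + toℕ r) , (uSide , q)) (sym (flip₀₁-3*+ i r)))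
    where
    edge : (r : Fin 3) → crossEdge i r ≡ ((vSide , 3 * i + toℕ r) , (uSide , 3 * i + toℕ (swap₀₁ r)))
    edge 0F = cong₂ (λ a b → (vSide , a) , (uSide , b)) (sym (+-identityʳ (3 * i))) (m<n⇒m%n≡m (3*+<3* i 1F i<n))
    edge 1F = cong (λ b → (vSide , 3 * i + 1) , (uSide , b)) (sym (+-identityʳ (3 * i)))
    edge 2F = refl

  endsAt-cross : ∀ {q} → q < N → endsAt (N + (N + q)) ≡ ((vSide , q) , (uSide , flip₀₁ q))
  endsAt-cross {q} q<N with residue₃ n q q<N
  ... | residue i r i<n refl =
    trans (nth-++ʳ _ (cycleEdges vSide) _ (length-cycleEdges vSide) (N + q))
      (trans (nth-++ʳ _ (cycleEdges uSide) _ (length-cycleEdges uSide) q)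
        (trans (nth-triples _ crossEdge (λ j → j) i<n r) (crossEdge≡ i<n r)))

  data Position (p : ℕ) : Set where
    at-cycle : ∀ s j → j < N → p ≡ offset s + j → Position p
    at-cross : ∀ q → q < N → p ≡ N + (N + q) → Position p

  position : ∀ {p} → p < N + (N + N) → Position p
  position {p} p<3N with p <? N
  ... | yes p<N = at-cycle vSide p p<N refl
  ... | no  p≮N with p ∸ N <? N
  ...   | yes p-N<N = at-cycle uSide (p ∸ N) p-N<N (sym (m+[n∸m]≡n (≮⇒≥ p≮N)))
  ...   | no  p-N≮N = at-cross (p ∸ N ∸ N) (+-cancelˡ-< N _ _ (+-cancelˡ-< N _ _ (subst (_< N + (N + N)) p≡ p<3N))) p≡
    where
    p≡ : p ≡ N + (N + (p ∸ N ∸ N))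
    p≡ = sym (trans (cong (N +_) (m+[n∸m]≡n (≮⇒≥ p-N≮N))) (m+[n∸m]≡n (≮⇒≥ p≮N)))

  cycle-pos< : ∀ s {j} → j < N → offset s + j < N + (N + N)
  cycle-pos< vSide j<N = <-≤-trans j<N (m≤m+n N (N + N))
  cycle-pos< uSide j<N = +-monoʳ-< N (<-≤-trans j<N (m≤m+n N N))

  cross-pos< : ∀ {q} → q < N → N + (N + q) < N + (N + N)
  cross-pos< q<N = +-monoʳ-< N (+-monoʳ-< N q<N)

  cycle-pos≢cross-pos : ∀ s {j} q → j < N → offset s + j ≢ N + (N + q)
  cycle-pos≢cross-pos s {j} q j<N eq = <-irrefl eq (<-≤-trans (below s) (+-monoʳ-≤ N (m≤m+n N q)))
    where
    below : ∀ s → offset s + j < N + N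
    below vSide = <-≤-trans j<N (m≤m+n N N)
    below uSide = +-monoʳ-< N j<N

  edgeAt : (p : ℕ) → p < N + (N + N) → Edge G
  edgeAt p p<3N = fromℕ< (subst (p <_) (sym length-edges) p<3N)

  toℕ-edgeAt : ∀ p p<3N → toℕ (edgeAt p p<3N) ≡ p
  toℕ-edgeAt p p<3N = toℕ-fromℕ< _

  toℕ-edge< : (e : Edge G) → toℕ e < N + (N + N)
  toℕ-edge< e = subst (toℕ e <_) length-edges (toℕ<n e)

  toℕ≡⇒≡edgeAt : ∀ {p} p<3N {e : Edge G} → toℕ e ≡ p → e ≡ edgeAt p p<3N
  toℕ≡⇒≡edgeAt p<3N e≡p = toℕ-injective (trans e≡p (sym (toℕ-edgeAt _ p<3N)))

  edgeAt-injective : ∀ {p q} p<3N q<3N → edgeAt p p<3N ≡ edgeAt q q<3N → p ≡ q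
  edgeAt-injective {p} {q} p<3N q<3N eq = trans (sym (toℕ-edgeAt p p<3N)) (trans (cong toℕ eq) (toℕ-edgeAt q q<3N))

  ends-at-position : (e : Edge G) {p : ℕ} {ys : XIV × XIV} → toℕ e ≡ p → endsAt p ≡ ys → ends G e ≡ ys
  ends-at-position e e≡p endsAt≡ = trans (ends≡endsAt e) (trans (cong endsAt e≡p) endsAt≡)

  ends-edgeAt : ∀ {p} p<3N {ys : XIV × XIV} → endsAt p ≡ ys → ends G (edgeAt p p<3N) ≡ ys
  ends-edgeAt {p} p<3N = ends-at-position (edgeAt p p<3N) (toℕ-edgeAt p p<3N)

  endpoint⇒incident : ∀ {x} (e : Edge G) {ys : XIV × XIV} → ends G e ≡ ys → x ≡ proj₁ ys ⊎ x ≡ proj₂ ys →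
                      incident G x e ≡ true
  endpoint⇒incident e refl (inj₁ refl) = incident-endpoint₁ G e
  endpoint⇒incident e refl (inj₂ refl) = incident-endpoint₂ G e

  incident⇒listed-endpoint : ∀ {x} (e : Edge G) {ys : XIV × XIV} → ends G e ≡ ys → incident G x e ≡ true →
                             x ≡ proj₁ ys ⊎ x ≡ proj₂ ys
  incident⇒listed-endpoint e ends≡ x∈e =
    Sum.map (λ x≡ → trans x≡ (cong proj₁ ends≡)) (λ x≡ → trans x≡ (cong proj₂ ends≡))
            (incident⇒endpoint G e x∈e)

  crossIndex : Side → ℕ → ℕ
  crossIndex vSide j = j
  crossIndex uSide j = flip₀₁ j

  crossIndex< : ∀ s {j} → j < N → crossIndex s j < N
  crossIndex< vSide j<N = j<N
  crossIndex< uSide j<N = flip₀₁< {n} j<N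

  forwardPos backwardPos crossPos : XIV → ℕ
  forwardPos  (s , j) = offset s + j
  backwardPos (s , j) = offset s + prev j
  crossPos    (s , j) = N + (N + crossIndex s j)

  IncidentPosition : XIV → ℕ → Set
  IncidentPosition x p = p ≡ forwardPos x ⊎ p ≡ backwardPos x ⊎ p ≡ crossPos x

  incident-position : ∀ x (e : Edge G) → incident G x e ≡ true → IncidentPosition x (toℕ e)
  incident-position x e x∈e with position (toℕ-edge< e)
  ... | at-cycle s j j<N e≡ = on-cycle (incident⇒listed-endpoint e (ends-at-position e e≡ (endsAt-cycle s j<N)) x∈e)
    where
    on-cycle : x ≡ (s , j) ⊎ x ≡ (s , next j) → IncidentPosition x (toℕ e)
    on-cycle (inj₁ refl) = inj₁ e≡
    on-cycle (inj₂ refl) = inj₂ (inj₁ (trans e≡ (cong (offset s +_) (sym (prev-next j<N)))))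
  ... | at-cross q q<N e≡ = on-cross (incident⇒listed-endpoint e (ends-at-position e e≡ (endsAt-cross q<N)) x∈e)
    where
    on-cross : x ≡ (vSide , q) ⊎ x ≡ (uSide , flip₀₁ q) → IncidentPosition x (toℕ e)
    on-cross (inj₁ refl) = inj₂ (inj₂ e≡)
    on-cross (inj₂ refl) = inj₂ (inj₂ (trans e≡ (cong (λ q′ → N + (N + q′)) (sym (flip₀₁-involutive q)))))

  module _ (s : Side) {j : ℕ} (j<N : j < N) where

    forward< : forwardPos (s , j) < N + (N + N)
    forward< = cycle-pos< s j<N

    backward< : backwardPos (s , j) < N + (N + N)
    backward< = cycle-pos< s (prev< j<N)

    cross< : crossPos (s , j) < N + (N + N)
    cross< = cross-pos< (crossIndex< s j<N)

    incidentExactly : IncidentExactly G (s , j) (edgeAt _ forward<) (edgeAt _ backward<) (edgeAt _ cross<)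
    incidentExactly = record
      { b≢a = λ eq → prev≢ 0<pred-N j (+-cancelˡ-≡ (offset s) _ _ (edgeAt-injective backward< forward< eq))
      ; d≢a = λ eq → cycle-pos≢cross-pos s _ j<N (sym (edgeAt-injective cross< forward< eq))
      ; d≢b = λ eq → cycle-pos≢cross-pos s _ (prev< j<N) (sym (edgeAt-injective cross< backward< eq))
      ; incident-a = endpoint⇒incident (edgeAt _ forward<) (ends-edgeAt forward< (endsAt-cycle s j<N)) (inj₁ refl)
      ; incident-b = endpoint⇒incident (edgeAt _ backward<) (ends-edgeAt backward< (endsAt-cycle s (prev< j<N)))
                       (inj₂ (cong (s ,_) (sym (next-prev j<N))))
      ; incident-d = endpoint⇒incident (edgeAt _ cross<) (ends-edgeAt cross< (endsAt-cross (crossIndex< s j<N)))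
                       (cross-endpoint s)
      ; only = λ e x∈e → Sum.map (toℕ≡⇒≡edgeAt forward<)
                           (Sum.map (toℕ≡⇒≡edgeAt backward<) (toℕ≡⇒≡edgeAt cross<))
                           (incident-position (s , j) e x∈e)
      }
      where
      0<pred-N : 0 < pred N
      0<pred-N = subst (0 <_) (sym pred-N) (≤-trans (s≤s z≤n) (m≤n+m 2 (3 * m)))
      cross-endpoint : ∀ s → (s , j) ≡ (vSide , crossIndex s j) ⊎ (s , j) ≡ (uSide , flip₀₁ (crossIndex s j))
      cross-endpoint vSide = inj₁ refl
      cross-endpoint uSide = inj₂ (cong (uSide ,_) (sym (flip₀₁-involutive j)))

  degree : ∀ {k} → (ℕ → Fin k) → Fin k → XIV → ℕ
  degree C i x = count₃ i (C (forwardPos x)) (C (backwardPos x)) (C (crossPos x))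

  colDeg≡degree : ∀ {k} (c : Coloring G k) (C : ℕ → Fin k) → (∀ e → c e ≡ C (toℕ e)) →
                  ∀ i s {j} → j < N → colDeg G c i (s , j) ≡ degree C i (s , j)
  colDeg≡degree c C c≗C i s {j} j<N =
    trans (colDeg≡count₃ G c i (incidentExactly s j<N))
      (count₃-cong i (colour-at (forward< s j<N)) (colour-at (backward< s j<N)) (colour-at (cross< s j<N)))
    where
    colour-at : ∀ {p} p<3N → c (edgeAt p p<3N) ≡ C p
    colour-at {p} p<3N = trans (c≗C _) (cong C (toℕ-edgeAt p p<3N))

  endpoints< : ∀ {p} → p < N + (N + N) → proj₂ (proj₁ (endsAt p)) < N × proj₂ (proj₂ (endsAt p)) < N
  endpoints< p<3N with position p<3N
  ... | at-cycle s j j<N refl rewrite endsAt-cycle s j<N = j<N , next< j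
  ... | at-cross q q<N refl rewrite endsAt-cross q<N = q<N , flip₀₁< {n} q<N

  DegreesDifferAt : ∀ {k} → (ℕ → Fin k) → ℕ → Set
  DegreesDifferAt C p = degree C (C p) (proj₁ (endsAt p)) ≢ degree C (C p) (proj₂ (endsAt p))

  IrregularAtPositions : ∀ {k} → (ℕ → Fin k) → Set
  IrregularAtPositions C = ∀ {p} → p < N + (N + N) → DegreesDifferAt C p

  module _ {k : ℕ} (c : Coloring G k) (C : ℕ → Fin k) (c≗C : ∀ e → c e ≡ C (toℕ e)) where

    private
      endpoint-degree : (e : Edge G) (end : XIV × XIV → XIV) → proj₂ (end (endsAt (toℕ e))) < N →
                        colDeg G c (c e) (end (ends G e)) ≡ degree C (C (toℕ e)) (end (endsAt (toℕ e)))
      endpoint-degree e end end<N = trans (cong₂ (colDeg G c) (c≗C e) (cong end (ends≡endsAt e)))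
                                          (colDeg≡degree c C c≗C _ (proj₁ (end (endsAt (toℕ e)))) end<N)

      endpoint-degrees : (e : Edge G) →
        colDeg G c (c e) (proj₁ (ends G e)) ≡ degree C (C (toℕ e)) (proj₁ (endsAt (toℕ e))) ×
        colDeg G c (c e) (proj₂ (ends G e)) ≡ degree C (C (toℕ e)) (proj₂ (endsAt (toℕ e)))
      endpoint-degrees e = endpoint-degree e proj₁ (proj₁ bounds) , endpoint-degree e proj₂ (proj₂ bounds)
        where bounds = endpoints< (toℕ-edge< e)

    irregular⇒irregularAtPositions : LocallyIrregularColoring G c → IrregularAtPositions C
    irregular⇒irregularAtPositions irregular {p} p<3N = subst (DegreesDifferAt C) (toℕ-edgeAt p p<3N)
      (λ eq → irregular e (trans (proj₁ (endpoint-degrees e)) (trans eq (sym (proj₂ (endpoint-degrees e))))))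
      where
      e : Edge G
      e = edgeAt p p<3N

    irregularAtPositions⇒irregular : IrregularAtPositions C → LocallyIrregularColoring G c
    irregularAtPositions⇒irregular irregular e eq =
      irregular (toℕ-edge< e) (trans (sym (proj₁ (endpoint-degrees e))) (trans eq (proj₂ (endpoint-degrees e))))

module XI-blocks (m : ℕ) where

  open XI-positions m
  module Blocks = Cyclic m

  block : ∀ {k} → (ℕ → Fin k) → ℕ → Block k
  block C i = record
    { v₀₁ = C (3 * i + 0)             ; v₁₂ = C (3 * i + 1)             ; v₂₃ = C (3 * i + 2)
    ; u₀₁ = C (N + (3 * i + 0))       ; u₁₂ = C (N + (3 * i + 1))       ; u₂₃ = C (N + (3 * i + 2))
    ; x₀  = C (N + (N + (3 * i + 0))) ; x₁  = C (N + (N + (3 * i + 1))) ; x₂  = C (N + (N + (3 * i + 2)))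
    }

  BlocksCompatible : ∀ {k} → (ℕ → Block k) → Set
  BlocksCompatible B = ∀ {i} → i < n → Compatible (interface (B (Blocks.prev i))) (B i)

  module _ {k : ℕ} (C : ℕ → Fin k) where

    cycleColour-block : ∀ s r i → cycleColour s r (block C i) ≡ C (offset s + (3 * i + toℕ r))
    cycleColour-block vSide 0F i = refl
    cycleColour-block vSide 1F i = refl
    cycleColour-block vSide 2F i = refl
    cycleColour-block uSide 0F i = refl
    cycleColour-block uSide 1F i = refl
    cycleColour-block uSide 2F i = refl

    crossColour-block : ∀ r i → crossColour r (block C i) ≡ C (N + (N + (3 * i + toℕ r)))
    crossColour-block 0F i = refl
    crossColour-block 1F i = refl
    crossColour-block 2F i = refl

  prev-block-start : ∀ {i} → i < n → prev (3 * i + 0) ≡ 3 * Blocks.prev i + 2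
  prev-block-start {zero}  _ = pred-N
  prev-block-start {suc i} _ =
    trans (cong prev (3*suc+ i 0)) (sym (trans (+-suc (3 * i) 1) (cong suc (+-suc (3 * i) 0))))

  prev-block-middle : ∀ i → prev (3 * i + 1) ≡ 3 * i + 0
  prev-block-middle i = cong prev (+-suc (3 * i) 0)

  prev-block-end : ∀ i → prev (3 * i + 2) ≡ 3 * i + 1
  prev-block-end i = cong prev (+-suc (3 * i) 1)

  crossIndex-block : ∀ s i r → crossIndex s (3 * i + toℕ r) ≡ 3 * i + toℕ (crossSlot s r)
  crossIndex-block vSide i r = refl
  crossIndex-block uSide i r = flip₀₁-3*+ i r

  module _ {k : ℕ} (C : ℕ → Fin k) where

    private
      colour-at-cycle : ∀ s r j {p} → p ≡ offset s + (3 * j + toℕ r) → C p ≡ cycleColour s r (block C j)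
      colour-at-cycle s r j refl = sym (cycleColour-block C s r j)

      colour-at-cross : ∀ s r i → C (N + (N + crossIndex s (3 * i + toℕ r))) ≡ crossColour (crossSlot s r) (block C i)
      colour-at-cross s r i =
        trans (cong (λ q → C (N + (N + q))) (crossIndex-block s i r)) (sym (crossColour-block C (crossSlot s r) i))

    degree-in-block : ∀ (col : Fin k) {i} → i < n → ∀ s r →
      degree C col (s , 3 * i + toℕ r) ≡ blockDegree s r (interface (block C (Blocks.prev i))) (block C i) col
    degree-in-block col {i} i<n s 0F = count₃-cong col (colour-at-cycle s 0F i refl)
      (trans (colour-at-cycle s 2F (Blocks.prev i) (cong (offset s +_) (prev-block-start i<n)))
             (sym (outgoing-interface s (block C (Blocks.prev i)))))
      (colour-at-cross s 0F i)
    degree-in-block col {i} i<n s 1F = count₃-cong col (colour-at-cycle s 1F i refl)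
      (colour-at-cycle s 0F i (cong (offset s +_) (prev-block-middle i))) (colour-at-cross s 1F i)
    degree-in-block col {i} i<n s 2F = count₃-cong col
      (trans (colour-at-cycle s 2F i refl) (sym (outgoing-interface s (block C i))))
      (trans (colour-at-cycle s 1F i (cong (offset s +_) (prev-block-end i))) (sym (inner-interface s (block C i))))
      (trans (colour-at-cross s 2F i) (cong (λ r → crossColour r (block C i)) (crossSlot-2F s)))

  module _ {i : ℕ} (i<n : i < n) where

    private
      next-in-block : ∀ r → 3 * i + suc r < N → next (3 * i + r) ≡ 3 * i + suc r
      next-in-block r 3i+r+1<N =
        trans (next-suc (subst (_< N) (+-suc (3 * i) r) 3i+r+1<N)) (sym (+-suc (3 * i) r))

    endsAt-block-cycle₀ : ∀ s → endsAt (offset s + (3 * i + 0)) ≡ ((s , 3 * i + 0) , (s , 3 * i + 1))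
    endsAt-block-cycle₀ s = trans (endsAt-cycle s (3*+<3* i 0F i<n))
      (cong (λ j → (s , 3 * i + 0) , (s , j)) (next-in-block 0 (3*+<3* i 1F i<n)))

    endsAt-block-cycle₁ : ∀ s → endsAt (offset s + (3 * i + 1)) ≡ ((s , 3 * i + 1) , (s , 3 * i + 2))
    endsAt-block-cycle₁ s = trans (endsAt-cycle s (3*+<3* i 1F i<n))
      (cong (λ j → (s , 3 * i + 1) , (s , j)) (next-in-block 1 (3*+<3* i 2F i<n)))

    endsAt-block-incoming : ∀ s →
      endsAt (offset s + (3 * Blocks.prev i + 2)) ≡ ((s , 3 * Blocks.prev i + 2) , (s , 3 * i + 0))
    endsAt-block-incoming s = trans (endsAt-cycle s (3*+<3* (Blocks.prev i) 2F (Blocks.prev< i<n)))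
      (cong (λ j → (s , 3 * Blocks.prev i + 2) , (s , j))
            (trans (cong next (sym (prev-block-start i<n))) (next-prev (3*+<3* i 0F i<n))))

    endsAt-block-cross : ∀ r →
      endsAt (N + (N + (3 * i + toℕ r))) ≡ ((vSide , 3 * i + toℕ r) , (uSide , 3 * i + toℕ (swap₀₁ r)))
    endsAt-block-cross r = trans (endsAt-cross (3*+<3* i r i<n))
      (cong (λ j → (vSide , 3 * i + toℕ r) , (uSide , j)) (flip₀₁-3*+ i r))

  module _ {k : ℕ} (C : ℕ → Fin k) where

    edge-constraint : ∀ {p s r j s′ r′ j′} {col : Fin k} → j < n → j′ < n →
      endsAt p ≡ ((s , 3 * j + toℕ r) , (s′ , 3 * j′ + toℕ r′)) → C p ≡ col →
      DegreesDifferAt C p ⇔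
      (blockDegree s r (interface (block C (Blocks.prev j))) (block C j) col ≢
       blockDegree s′ r′ (interface (block C (Blocks.prev j′))) (block C j′) col)
    edge-constraint {p} {s} {r} {j} {s′} {r′} {j′} j<n j′<n endsAt≡ refl rewrite endsAt≡ =
      mk⇔ (λ differ eq → differ (trans (at-x _) (trans eq (sym (at-y _)))))
          (λ differ eq → differ (trans (sym (at-x _)) (trans eq (at-y _))))
      where
      at-x : ∀ col → degree C col (s , 3 * j + toℕ r) ≡ blockDegree s r (interface (block C (Blocks.prev j))) (block C j) col
      at-x col = degree-in-block C col j<n s r
      at-y : ∀ col → degree C col (s′ , 3 * j′ + toℕ r′) ≡
                     blockDegree s′ r′ (interface (block C (Blocks.prev j′))) (block C j′) col
      at-y col = degree-in-block C col j′<n s′ r′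

    irregular⇒blocksCompatible : IrregularAtPositions C → BlocksCompatible (block C)
    irregular⇒blocksCompatible irregular {i} i<n = record { cycle = cycle ; cross = cross }
      where
      pi<n : Blocks.prev i < n
      pi<n = Blocks.prev< i<n
      cycle : ∀ s → CycleCompatible s (interface (block C (Blocks.prev i))) (block C i)
      cycle s =
        Equivalence.to (edge-constraint pi<n i<n (endsAt-block-incoming i<n s)
                          (sym (trans (outgoing-interface s _) (cycleColour-block C s 2F (Blocks.prev i)))))
          (irregular (cycle-pos< s (3*+<3* (Blocks.prev i) 2F pi<n))) ,
        Equivalence.to (edge-constraint i<n i<n (endsAt-block-cycle₀ i<n s) (sym (cycleColour-block C s 0F i)))
          (irregular (cycle-pos< s (3*+<3* i 0F i<n))) ,
        Equivalence.to (edge-constraint i<n i<n (endsAt-block-cycle₁ i<n s) (sym (cycleColour-block C s 1F i)))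
          (irregular (cycle-pos< s (3*+<3* i 1F i<n)))
      cross : ∀ r → CrossCompatible r (interface (block C (Blocks.prev i))) (block C i)
      cross r = Equivalence.to (edge-constraint i<n i<n (endsAt-block-cross i<n r) (sym (crossColour-block C r i)))
        (irregular (cross-pos< (3*+<3* i r i<n)))

    blocksCompatible⇒irregular : BlocksCompatible (block C) → IrregularAtPositions C
    blocksCompatible⇒irregular compatible p<3N with position p<3N
    ... | at-cycle s j j<N refl with residue₃ n j j<N
    ...   | residue i 0F i<n refl = Equivalence.from
      (edge-constraint i<n i<n (endsAt-block-cycle₀ i<n s) (sym (cycleColour-block C s 0F i)))
      (proj₁ (proj₂ (Compatible.cycle (compatible i<n) s)))
    ...   | residue i 1F i<n refl = Equivalence.from
      (edge-constraint i<n i<n (endsAt-block-cycle₁ i<n s) (sym (cycleColour-block C s 1F i)))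
      (proj₂ (proj₂ (Compatible.cycle (compatible i<n) s)))
    ...   | residue i 2F i<n refl =
      subst (λ j → DegreesDifferAt C (offset s + (3 * j + 2))) (Blocks.prev-next i<n) (Equivalence.from
        (edge-constraint (Blocks.prev< i+1<n) i+1<n (endsAt-block-incoming i+1<n s)
           (sym (trans (outgoing-interface s _) (cycleColour-block C s 2F (Blocks.prev (Blocks.next i))))))
        (proj₁ (Compatible.cycle (compatible i+1<n) s)))
      where
      i+1<n : Blocks.next i < n
      i+1<n = Blocks.next< i
    blocksCompatible⇒irregular compatible p<3N | at-cross q q<N refl with residue₃ n q q<N
    ... | residue i r i<n refl = Equivalence.from
      (edge-constraint i<n i<n (endsAt-block-cross i<n r) (sym (crossColour-block C r i)))
      (Compatible.cross (compatible i<n) r)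

module XI-colourings (m : ℕ) where

  open XI-positions m
  open XI-blocks m

  module _ {k : ℕ} (B : ℕ → Block k) where

    cycleColours : Side → List (Fin k)
    cycleColours s = triples (λ i r → cycleColour s r (B i)) (upTo n)

    crossColours : List (Fin k)
    crossColours = triples (λ i r → crossColour r (B i)) (upTo n)

    length-cycleColours : ∀ s → length (cycleColours s) ≡ N
    length-cycleColours s = length-triples (λ i r → cycleColour s r (B i)) (λ j → j) n

    colouring : ℕ → Fin k
    colouring = nth (Block.v₀₁ (B 0)) (cycleColours vSide ++ (cycleColours uSide ++ crossColours))

    colouring-cycle : ∀ s {i} → i < n → ∀ r → colouring (offset s + (3 * i + toℕ r)) ≡ cycleColour s r (B i)
    colouring-cycle vSide {i} i<n r =
      trans (nth-++ˡ _ (cycleColours vSide) _ (length-cycleColours vSide) (3*+<3* i r i<n))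
            (nth-triples _ (λ j r → cycleColour vSide r (B j)) (λ j → j) i<n r)
    colouring-cycle uSide {i} i<n r =
      trans (nth-++ʳ _ (cycleColours vSide) _ (length-cycleColours vSide) (3 * i + toℕ r))
        (trans (nth-++ˡ _ (cycleColours uSide) _ (length-cycleColours uSide) (3*+<3* i r i<n))
               (nth-triples _ (λ j r → cycleColour uSide r (B j)) (λ j → j) i<n r))

    colouring-cross : ∀ {i} → i < n → ∀ r → colouring (N + (N + (3 * i + toℕ r))) ≡ crossColour r (B i)
    colouring-cross {i} i<n r =
      trans (nth-++ʳ _ (cycleColours vSide) _ (length-cycleColours vSide) (N + (3 * i + toℕ r)))
        (trans (nth-++ʳ _ (cycleColours uSide) _ (length-cycleColours uSide) (3 * i + toℕ r))
               (nth-triples _ (λ j r → crossColour r (B j)) (λ j → j) i<n r))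

    block-colouring : ∀ {i} → i < n → block colouring i ≡ B i
    block-colouring {i} i<n = block-ext (λ s r → trans (cycleColour-block colouring s r i) (colouring-cycle s i<n r))
                                        (λ r → trans (crossColour-block colouring r i) (colouring-cross i<n r))

    irrColorable-from-blocks : BlocksCompatible B → IrrColorable G k
    irrColorable-from-blocks compatible =
      (λ e → colouring (toℕ e)) ,
      irregularAtPositions⇒irregular _ colouring (λ _ → refl) (blocksCompatible⇒irregular colouring compatible′)
      where
      compatible′ : BlocksCompatible (block colouring)
      compatible′ i<n = subst₂ Compatible (cong interface (sym (block-colouring (Blocks.prev< i<n))))
                                          (sym (block-colouring i<n)) (compatible i<n)

  0<N : 0 < N
  0<N = s≤s z≤n

  not-irrColorable-0 : ¬ IrrColorable G 0
  not-irrColorable-0 = no-irrColoring-with-no-colours G (edgeAt 0 (cycle-pos< vSide 0<N))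

  not-irrColorable-1 : ¬ IrrColorable G 1
  not-irrColorable-1 = no-irrColoring-with-one-colour G (edgeAt 0 (cycle-pos< vSide 0<N))
    (ends-edgeAt (cycle-pos< vSide 0<N) (endsAt-cycle vSide 0<N)) (incidentExactly vSide 0<N) (incidentExactly vSide (next< 0))

  not-irrColorable-2 : parity n ≡ 1ℙ → ¬ IrrColorable G 2
  not-irrColorable-2 odd (c , irregular) = 0ℙ≢1ℙ (trans (sym (closed-descending-walk-even φ m step close)) odd)
    where
    C : ℕ → Fin 2
    C = extend 0F c
    compatible : BlocksCompatible (block C)
    compatible = irregular⇒blocksCompatible C (irregular⇒irregularAtPositions c C (extend-toℕ 0F c) irregular)
    φ : ℕ → ℕ × Parity
    φ i = potential (interface (block C i))
    step : ∀ {i} → i < m → Descends (φ i) (φ (suc i))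
    step i<m = compatible⇒descends _ _ (compatible (s≤s i<m))
    close : Descends (φ m) (φ 0)
    close = compatible⇒descends _ _ (compatible (s≤s z≤n))
    0ℙ≢1ℙ : 0ℙ ≢ 1ℙ
    0ℙ≢1ℙ ()

  alternating : Parity → Block 2
  alternating 0ℙ = ⟨ 0F , 0F , 0F ∣ 0F , 0F , 1F ∣ 0F , 0F , 1F ⟩
  alternating 1ℙ = ⟨ 0F , 0F , 1F ∣ 1F , 1F , 1F ∣ 0F , 1F , 1F ⟩

  alternating-compatible : ∀ p → Compatible (interface (alternating p)) (alternating (p ⁻¹))
  alternating-compatible 0ℙ = from-yes (compatible? (interface (alternating 0ℙ)) (alternating 1ℙ))
  alternating-compatible 1ℙ = from-yes (compatible? (interface (alternating 1ℙ)) (alternating 0ℙ))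

  irrColorable-2 : parity n ≡ 0ℙ → IrrColorable G 2
  irrColorable-2 even = irrColorable-from-blocks (λ i → alternating (parity i)) compatible
    where
    compatible : BlocksCompatible (λ i → alternating (parity i))
    compatible {zero}  _ = subst (λ p → Compatible (interface (alternating p)) (alternating 0ℙ))
                                 (trans (cong _⁻¹ (sym even)) (suc-homo-⁻¹ m)) (alternating-compatible 1ℙ)
    compatible {suc i} _ = subst (λ p → Compatible (interface (alternating (parity i))) (alternating p))
                                 (⁻¹-selfInverse (suc-homo-⁻¹ i)) (alternating-compatible (parity i))

  constant : Block 3
  constant = ⟨ 0F , 0F , 1F ∣ 0F , 2F , 2F ∣ 1F , 0F , 0F ⟩

  irrColorable-3 : IrrColorable G 3
  irrColorable-3 = irrColorable-from-blocks (λ _ → constant) (λ _ → from-yes (compatible? (interface constant) constant))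

  irrChromaticIndex-2 : parity n ≡ 0ℙ → IrrChromaticIndex G 2
  irrChromaticIndex-2 even = irrColorable-2 even , fewer
    where
    fewer : (j : ℕ) → j < 2 → ¬ IrrColorable G j
    fewer 0 _ = not-irrColorable-0
    fewer 1 _ = not-irrColorable-1
    fewer (suc (suc _)) (s≤s (s≤s ()))

  irrChromaticIndex-3 : parity n ≡ 1ℙ → IrrChromaticIndex G 3
  irrChromaticIndex-3 odd = irrColorable-3 , fewer
    where
    fewer : (j : ℕ) → j < 3 → ¬ IrrColorable G j
    fewer 0 _ = not-irrColorable-0
    fewer 1 _ = not-irrColorable-1
    fewer 2 _ = not-irrColorable-2 odd
    fewer (suc (suc (suc _))) (s≤s (s≤s (s≤s ())))

theorem9 : (k : ℕ) → 1 ≤ k →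
    IrrChromaticIndex (XI (2 * k)) 2 × IrrChromaticIndex (XI (2 * k + 1)) 3
theorem9 zero    ()
theorem9 (suc k) _ =
  XI-colourings.irrChromaticIndex-2 (pred (2 * suc k)) parity-2k≡0 ,
  XI-colourings.irrChromaticIndex-3 (pred (2 * suc k + 1)) parity-2k+1≡1
  where
  parity-2k≡0 : parity (2 * suc k) ≡ 0ℙ
  parity-2k≡0 = *-homo-* 2 (suc k)
  parity-2k+1≡1 : parity (2 * suc k + 1) ≡ 1ℙ
  parity-2k+1≡1 = trans (+-homo-+ (2 * suc k) 1) (cong (_+ℙ 1ℙ) parity-2k≡0)
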